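{- Let $(a_i)$ be a representing sequence and let $w$ be its representation word. The following are equivalent: (1) $w$ is Fergusonian; (2) every occurrence of $a_1$ in $w$ is immediately preceded by either $a_1-1$ or $a_1$; (3) for all $n\ge0$, $w[n]=a_1$ if and only if $n$ is a volatile zend.
   Context: A representing sequence is a strictly increasing sequence $(a_i)_{i\ge0}$ of positive integers with $a_0=1$. For $n\ge1$ with $a_j\le n<a_{j+1}$, the $(a_i)$-representation of $n$ is the digit string $d_j\cdots d_0$ with $n=\sum d_ia_i$ and $\sum d_i$ minimal (greedy); the representation of $0$ is the digit $0$. $n$ is a zend if its representation ends in $0$. $n\ge0$ is volatile if the representation of $n+1$ ends in at least one zero, and $2$-volatile if it ends in at least two zeros. The representation word of $(a_i)$ is the infinite word $w$ over $\{0,\dots,a_1\}$ with $w[n]=a_1$ if $n$ is $2$-volatile, and otherwise $w[n]$ is the last digit of the representation of $n$. A word over $\{0,\dots,k\}$ ($k\ge2$; here $k=a_1$) is Fergusonian if for every $0\le i<k-1$ every occurrence of $i$ is immediately followed by $i+1$ and every occurrence of $i+1$ is immediately preceded by $i$. -}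

module Defs where

open import Data.Nat using (ℕ; zero; suc; _+_; _∸_; _≤_; _<_; _/_; _%_; _≤ᵇ_; _≡ᵇ_)
open import Data.Bool using (Bool; true; false; if_then_else_; _∧_)
open import Data.Product using (Σ; _×_; _,_)
open import Data.Sum using (_⊎_)
open import Relation.Binary.PropositionalEquality using (_≡_)

-- A representing sequence: strictly increasing sequence of positive integers with a 0 = 1.
-- (Positivity follows from a 0 ≡ 1 and strict increase.)
IsRepresentingSequence : (ℕ → ℕ) → Set
IsRepresentingSequence a = (a 0 ≡ 1) × (∀ i → a i < a (suc i))

-- Total division / modulus (the divisor is never 0 for a representing sequence).
divA : ℕ → ℕ → ℕ
divA x zero    = 0
divA x (suc d) = x / suc d

modA : ℕ → ℕ → ℕ
modA x zero    = x
modA x (suc d) = x % suc d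

-- Greedy algorithm, processing positions n, n-1, ..., 0 top-down
-- (positions i > n have a i > n and contribute digit 0).
-- restAfter a n t = value still to be represented after processing the
-- t positions n, n-1, ..., n-t+1, i.e. just before position n ∸ t.
restAfter : (ℕ → ℕ) → ℕ → ℕ → ℕ
restAfter a n zero    = n
restAfter a n (suc t) = modA (restAfter a n t) (a (n ∸ t))

-- The digit d_i of the greedy (a_i)-representation of n (for i ≤ n; it is 0 beyond).
digit : (ℕ → ℕ) → ℕ → ℕ → ℕ
digit a n i = divA (restAfter a n (n ∸ i)) (a i)

-- Last digit d_0 of the representation of n (the representation of 0 is "0").
lastDigit : (ℕ → ℕ) → ℕ → ℕ
lastDigit a n = digit a n 0

Zend : (ℕ → ℕ) → ℕ → Set
Zend a n = lastDigit a n ≡ 0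

Volatile : (ℕ → ℕ) → ℕ → Set
Volatile a n = lastDigit a (suc n) ≡ 0

-- n is 2-volatile: the representation of n+1 has at least two digits
-- (i.e. a 1 ≤ n+1) and its last two digits d_1 d_0 are 0.
twoVolatileᵇ : (ℕ → ℕ) → ℕ → Bool
twoVolatileᵇ a n = (a 1 ≤ᵇ suc n) ∧ ((digit a (suc n) 0 ≡ᵇ 0) ∧ (digit a (suc n) 1 ≡ᵇ 0))

repWord : (ℕ → ℕ) → ℕ → ℕ
repWord a n = if twoVolatileᵇ a n then a 1 else lastDigit a n

Fergusonian : ℕ → (ℕ → ℕ) → Set
Fergusonian k w =
  ∀ i → suc i < k →
    (∀ n → w n ≡ i → w (suc n) ≡ suc i) ×
    (∀ m → w m ≡ suc i → Σ ℕ λ n → (m ≡ suc n) × (w n ≡ i))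

-- Let r n = d₁ a₁ + d₀ be the value of the last two greedy digits of n.
-- Going from n to n+1, r either increases by one or drops to 0 (a carry out of
-- position 1); n is 2-volatile exactly when r (n+1) = 0, and the last digit of n
-- is r n mod a₁.  So the representation word is the counter r mod a₁, with the
-- letter a₁ written just before each reset.  Letters below a₁ - 1 are always
-- followed by their successor unless a reset intervenes, and all three
-- conditions say that a reset never happens right after a letter below a₁ - 1,
-- i.e. r only resets from a multiple of a₁.
module Submission where

open import Defs
open import Data.Nat using (ℕ; zero; suc; _∸_; _≤_; _<_; _%_; _/_; _+_; _*_; z≤n; s≤s; _≤?_; _≤ᵇ_; NonZero)
open import Data.Nat.Properties
open import Data.Nat.DivMod
open import Data.Bool using (T; true; false)
open import Data.Bool.Properties using (T-≡; T-∧)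
open import Data.Product using (Σ; _×_; _,_; proj₁; proj₂)
open import Data.Sum using (_⊎_; inj₁; inj₂; swap)
import Data.Sum as Sum
open import Data.Empty using (⊥-elim)
open import Function.Bundles using (_⇔_; mk⇔; Equivalence)
open import Relation.Nullary using (yes; no)
open import Relation.Binary.PropositionalEquality
  using (_≡_; _≢_; refl; sym; trans; cong; cong₂; subst; module ≡-Reasoning)

open Equivalence using (to; from)

modA-zero : ∀ d → modA 0 d ≡ 0
modA-zero zero    = refl
modA-zero (suc d) = refl

divA-zero : ∀ d → divA 0 d ≡ 0
divA-zero zero    = refl
divA-zero (suc d) = refl

modA<d : ∀ x {d} → 0 < d → modA x d < d
modA<d x {suc e} _ = m%n<n x (suc e)

modA-small : ∀ {x d} → x < d → modA x d ≡ x
modA-small {d = suc e} = m<n⇒m%n≡m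

x≡modA+divA*d : ∀ x d → x ≡ modA x d + divA x d * d
x≡modA+divA*d x zero    = sym (+-identityʳ x)
x≡modA+divA*d x (suc e) = m≡m%n+[m/n]*n x (suc e)

modA≡0∧divA≡0⇒≡0 : ∀ {x} d → modA x d ≡ 0 → divA x d ≡ 0 → x ≡ 0
modA≡0∧divA≡0⇒≡0 {x} d r≡0 q≡0 = begin
  x                          ≡⟨ x≡modA+divA*d x d ⟩
  modA x d + divA x d * d    ≡⟨ cong₂ (λ r q → r + q * d) r≡0 q≡0 ⟩
  0                          ∎
  where open ≡-Reasoning

[1+m]%n≡[1+m%n]%n : ∀ m n .{{_ : NonZero n}} → suc m % n ≡ suc (m % n) % n
[1+m]%n≡[1+m%n]%n m n = trans (cong (λ x → suc x % n) (m≡m%n+[m/n]*n m n)) ([m+kn]%n≡m%n (suc (m % n)) (m / n) n)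

modA-suc : ∀ x {d} → 0 < d →
  (modA x d ≡ d ∸ 1 × modA (suc x) d ≡ 0) ⊎
  (suc (modA x d) < d × modA (suc x) d ≡ suc (modA x d))
modA-suc x {suc e} _ with m≤n⇒m<n∨m≡n (m%n<n x (suc e))
... | inj₁ lt = inj₂ (lt , trans ([1+m]%n≡[1+m%n]%n x (suc e)) (m<n⇒m%n≡m lt))
... | inj₂ eq = inj₁ (suc-injective eq ,
  trans ([1+m]%n≡[1+m%n]%n x (suc e)) (trans (cong (_% suc e) eq) (n%n≡0 (suc e))))

1+m<n⇒m≢n∸1 : ∀ {m n} → suc m < n → m ≢ n ∸ 1
1+m<n⇒m≢n∸1 lt = <⇒≢ (∸-monoˡ-< lt (s≤s z≤n))

TopPreceded : ℕ → (ℕ → ℕ) → Set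
TopPreceded k w = ∀ m → w m ≡ k → Σ ℕ λ n → (m ≡ suc n) × ((w n ≡ k ∸ 1) ⊎ (w n ≡ k))

fergusonian⇒topPreceded : ∀ {k w} → (∀ n → w n ≤ k) → w 0 ≢ k →
  Fergusonian k w → TopPreceded k w
fergusonian⇒topPreceded bounded w0≢k ferg zero top = ⊥-elim (w0≢k top)
fergusonian⇒topPreceded {k} {w} bounded w0≢k ferg (suc n) top
  with w n ≟ k | w n ≟ k ∸ 1
... | yes top′ | _       = n , refl , inj₂ top′
... | no _     | yes pre = n , refl , inj₁ pre
... | no ¬top  | no ¬pre = ⊥-elim (<⇒≢ 1+wn<k (trans (sym next) top))
  where
  1+wn<k : suc (w n) < k
  1+wn<k = ≤∧≢⇒< (≤∧≢⇒< (bounded n) ¬top) (λ eq → ¬pre (cong (_∸ 1) eq))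
  next : w (suc n) ≡ suc (w n)
  next = proj₁ (ferg (w n) 1+wn<k) n refl

module ResettingCounter
  {d : ℕ} (2≤d : 2 ≤ d)
  (r : ℕ → ℕ) (r0≡0 : r 0 ≡ 0) (r1≡1 : r 1 ≡ 1)
  (r-step : ∀ n → r (suc n) ≡ suc (r n) ⊎ r (suc n) ≡ 0)
  (ℓ : ℕ → ℕ) (ℓ≡r%d : ∀ n → ℓ n ≡ modA (r n) d)
  (w : ℕ → ℕ)
  (w-reset : ∀ n → r (suc n) ≡ 0 → w n ≡ d)
  (w-count : ∀ n → r (suc n) ≢ 0 → w n ≡ ℓ n)
  where

  TopsAreVolatileZends : Set
  TopsAreVolatileZends = ∀ n → w n ≡ d ⇔ (ℓ (suc n) ≡ 0 × ℓ n ≡ 0)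

  0<d : 0 < d
  0<d = ≤-trans (s≤s z≤n) 2≤d

  ℓ<d : ∀ n → ℓ n < d
  ℓ<d n = subst (_< d) (sym (ℓ≡r%d n)) (modA<d (r n) 0<d)

  ℓ-reset : ∀ {n} → r n ≡ 0 → ℓ n ≡ 0
  ℓ-reset {n} r≡0 = trans (ℓ≡r%d n) (trans (cong (λ x → modA x d) r≡0) (modA-zero d))

  ℓ-step : ∀ n → r (suc n) ≢ 0 →
    (ℓ n ≡ d ∸ 1 × ℓ (suc n) ≡ 0) ⊎ (suc (ℓ n) < d × ℓ (suc n) ≡ suc (ℓ n))
  ℓ-step n no-reset with r-step n
  ... | inj₂ reset = ⊥-elim (no-reset reset)
  ... | inj₁ count rewrite ℓ≡r%d n | ℓ≡r%d (suc n) | count = modA-suc (r n) 0<d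

  w≡d⇒reset : ∀ {n} → w n ≡ d → r (suc n) ≡ 0
  w≡d⇒reset {n} top with r (suc n) ≟ 0
  ... | yes reset    = reset
  ... | no no-reset = ⊥-elim (<⇒≢ (ℓ<d n) (trans (sym (w-count n no-reset)) top))

  w≢d⇒w≡ℓ : ∀ {n} → w n ≢ d → w n ≡ ℓ n
  w≢d⇒w≡ℓ {n} ¬top = w-count n (λ reset → ¬top (w-reset n reset))

  w≤d : ∀ n → w n ≤ d
  w≤d n with r (suc n) ≟ 0
  ... | yes reset    = ≤-reflexive (w-reset n reset)
  ... | no no-reset = subst (_≤ d) (sym (w-count n no-reset)) (<⇒≤ (ℓ<d n))

  w0≡0 : w 0 ≡ 0
  w0≡0 = trans (w-count 0 (subst (_≢ 0) (sym r1≡1) λ ())) (ℓ-reset r0≡0)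

  w0≢d : w 0 ≢ d
  w0≢d top = <⇒≢ 0<d (trans (sym w0≡0) top)

  topPreceded⇒fergusonian : TopPreceded d w → Fergusonian d w
  topPreceded⇒fergusonian preceded i 1+i<d = successor , predecessor
    where
    i≢d∸1 : i ≢ d ∸ 1
    i≢d∸1 = 1+m<n⇒m≢n∸1 1+i<d

    successor : ∀ n → w n ≡ i → w (suc n) ≡ suc i
    successor n wn≡i = trans (w≢d⇒w≡ℓ ¬next-top) ℓ-next
      where
      ¬top : w n ≢ d
      ¬top top = <⇒≢ (<⇒≤ 1+i<d) (trans (sym wn≡i) top)
      ℓn≡i : ℓ n ≡ i
      ℓn≡i = trans (sym (w≢d⇒w≡ℓ ¬top)) wn≡i
      ℓ-next : ℓ (suc n) ≡ suc i
      ℓ-next with ℓ-step n (λ reset → ¬top (w-reset n reset))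
      ... | inj₁ (ℓn≡d∸1 , _) = ⊥-elim (i≢d∸1 (trans (sym ℓn≡i) ℓn≡d∸1))
      ... | inj₂ (_ , ℓ-succ) = trans ℓ-succ (cong suc ℓn≡i)
      ¬next-top : w (suc n) ≢ d
      ¬next-top next-top with preceded (suc n) next-top
      ... | _ , refl , inj₁ pre  = i≢d∸1 (trans (sym wn≡i) pre)
      ... | _ , refl , inj₂ top = ¬top top

    predecessor : ∀ m → w m ≡ suc i → Σ ℕ λ n → (m ≡ suc n) × (w n ≡ i)
    predecessor zero    w0≡1+i = ⊥-elim (0≢1+n (trans (sym w0≡0) w0≡1+i))
    predecessor (suc n) wm≡1+i = n , refl , trans (w-count n no-reset) ℓn≡i
      where
      ℓm≡1+i : ℓ (suc n) ≡ suc i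
      ℓm≡1+i = trans (sym (w≢d⇒w≡ℓ (λ top → <⇒≢ 1+i<d (trans (sym wm≡1+i) top)))) wm≡1+i
      no-reset : r (suc n) ≢ 0
      no-reset reset = 0≢1+n (trans (sym (ℓ-reset reset)) ℓm≡1+i)
      ℓn≡i : ℓ n ≡ i
      ℓn≡i with ℓ-step n no-reset
      ... | inj₁ (_ , ℓm≡0)   = ⊥-elim (0≢1+n (trans (sym ℓm≡0) ℓm≡1+i))
      ... | inj₂ (_ , ℓ-succ) = suc-injective (trans (sym ℓ-succ) ℓm≡1+i)

  top⇒zend : TopPreceded d w → ∀ n → w n ≡ d → ℓ n ≡ 0
  top⇒zend preceded zero    _   = ℓ-reset r0≡0
  top⇒zend preceded (suc n) top with r (suc n) ≟ 0
  ... | yes reset    = ℓ-reset reset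
  ... | no no-reset with preceded (suc n) top | ℓ-step n no-reset
  ... | _ , refl , inj₂ top′ | _                  = ⊥-elim (no-reset (w≡d⇒reset top′))
  ... | _ , refl , inj₁ _    | inj₁ (_ , ℓm≡0)    = ℓm≡0
  ... | _ , refl , inj₁ pre  | inj₂ (1+ℓn<d , _) =
    ⊥-elim (1+m<n⇒m≢n∸1 1+ℓn<d (trans (sym (w-count n no-reset)) pre))

  volatileZend⇒top : ∀ n → ℓ (suc n) ≡ 0 × ℓ n ≡ 0 → w n ≡ d
  volatileZend⇒top n (ℓm≡0 , ℓn≡0) with r (suc n) ≟ 0
  ... | yes reset    = w-reset n reset
  ... | no no-reset with ℓ-step n no-reset
  ... | inj₁ (ℓn≡d∸1 , _) = ⊥-elim (<⇒≢ (∸-monoˡ-≤ 1 2≤d) (trans (sym ℓn≡0) ℓn≡d∸1))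
  ... | inj₂ (_ , ℓ-next) = ⊥-elim (0≢1+n (trans (sym ℓm≡0) ℓ-next))

  topsAreVolatileZends⇒topPreceded : TopsAreVolatileZends → TopPreceded d w
  topsAreVolatileZends⇒topPreceded tops zero    top = ⊥-elim (w0≢d top)
  topsAreVolatileZends⇒topPreceded tops (suc n) top with w n ≟ d
  ... | yes top′ = n , refl , inj₂ top′
  ... | no ¬top  = n , refl , inj₁ (trans (w≢d⇒w≡ℓ ¬top) ℓn≡d∸1)
    where
    ℓn≡d∸1 : ℓ n ≡ d ∸ 1
    ℓn≡d∸1 with ℓ-step n (λ reset → ¬top (w-reset n reset))
    ... | inj₁ (ℓn≡d∸1 , _) = ℓn≡d∸1
    ... | inj₂ (_ , ℓ-next) = ⊥-elim (0≢1+n (trans (sym (proj₂ (to (tops (suc n)) top))) ℓ-next))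

  fergusonian⇔topPreceded : Fergusonian d w ⇔ TopPreceded d w
  fergusonian⇔topPreceded = mk⇔ (fergusonian⇒topPreceded w≤d w0≢d) topPreceded⇒fergusonian

  topPreceded⇔topsAreVolatileZends : TopPreceded d w ⇔ TopsAreVolatileZends
  topPreceded⇔topsAreVolatileZends = mk⇔
    (λ preceded n → mk⇔ (λ top → ℓ-reset (w≡d⇒reset top) , top⇒zend preceded n top)
                        (volatileZend⇒top n))
    topsAreVolatileZends⇒topPreceded

-- The value d₁ a₁ + d₀ of the last two digits of the representation of n.
lowPart : (ℕ → ℕ) → ℕ → ℕ
lowPart a n = restAfter a n (n ∸ 1)

module RepresentingSequence {a : ℕ → ℕ} (a0≡1 : a 0 ≡ 1) (a-increasing : ∀ i → a i < a (suc i)) where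

  n<aₙ : ∀ n → n < a n
  n<aₙ zero    = subst (0 <_) (sym a0≡1) (s≤s z≤n)
  n<aₙ (suc n) = ≤-trans (s≤s (n<aₙ n)) (a-increasing n)

  a₁≤aₙ : ∀ {n} → 0 < n → a 1 ≤ a n
  a₁≤aₙ {suc zero}    _ = ≤-refl
  a₁≤aₙ {suc (suc n)} _ = ≤-trans (a₁≤aₙ {suc n} (s≤s z≤n)) (<⇒≤ (a-increasing (suc n)))

  restAfter-suc : ∀ n t →
    restAfter a (suc n) (suc t) ≡ suc (restAfter a n t) ⊎ restAfter a (suc n) (suc t) ≡ 0
  restAfter-suc n zero = inj₁ (modA-small (n<aₙ (suc n)))
  restAfter-suc n (suc t) with restAfter-suc n t
  ... | inj₁ count rewrite count =
    swap (Sum.map proj₂ proj₂ (modA-suc (restAfter a n t) (≤-<-trans z≤n (n<aₙ (n ∸ t)))))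
  ... | inj₂ reset rewrite reset = inj₂ (modA-zero (a (n ∸ t)))

  lowPart-step : ∀ n → lowPart a (suc n) ≡ suc (lowPart a n) ⊎ lowPart a (suc n) ≡ 0
  lowPart-step zero    = inj₁ refl
  lowPart-step (suc n) = restAfter-suc (suc n) n

  restAfter-fixed : ∀ n t → (∀ s → s < t → n < a (n ∸ s)) → restAfter a n t ≡ n
  restAfter-fixed n zero    _     = refl
  restAfter-fixed n (suc t) small rewrite restAfter-fixed n t (λ s s<t → small s (m<n⇒m<1+n s<t)) =
    modA-small (small t ≤-refl)

  lowPart-small : ∀ {n} → n < a 1 → lowPart a n ≡ n
  lowPart-small {n} n<a₁ = restAfter-fixed n (n ∸ 1) λ s s<n∸1 →
    <-≤-trans n<a₁ (a₁≤aₙ (m<n⇒0<n∸m (<-≤-trans s<n∸1 (m∸n≤m n 1))))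

  lowPart≡0⇒a₁≤ : ∀ {n} → lowPart a (suc n) ≡ 0 → a 1 ≤ suc n
  lowPart≡0⇒a₁≤ {n} reset with a 1 ≤? suc n
  ... | yes a₁≤ = a₁≤
  ... | no a₁≰  = ⊥-elim (0≢1+n (trans (sym reset) (lowPart-small (≰⇒> a₁≰))))

  divA-a₀ : ∀ x → divA x (a 0) ≡ x
  divA-a₀ x rewrite a0≡1 = n/1≡n x

  lastDigit≡lowPart%a₁ : ∀ n → lastDigit a n ≡ modA (lowPart a n) (a 1)
  lastDigit≡lowPart%a₁ zero    = trans (divA-a₀ 0) (sym (modA-zero (a 1)))
  lastDigit≡lowPart%a₁ (suc n) =
    trans (divA-a₀ _) (cong (λ i → modA (lowPart a (suc n)) (a i)) (m+n∸n≡m 1 n))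

  twoVolatile⇔lowPart≡0 : ∀ n → T (twoVolatileᵇ a n) ⇔ lowPart a (suc n) ≡ 0
  twoVolatile⇔lowPart≡0 n = mk⇔ reset-of reset-to
    where
    reset-of : T (twoVolatileᵇ a n) → lowPart a (suc n) ≡ 0
    reset-of tv with to (T-∧ {a 1 ≤ᵇ suc n}) tv
    ... | _ , digits with to T-∧ digits
    ... | d₀≡0 , d₁≡0 = modA≡0∧divA≡0⇒≡0 (a 1)
      (trans (sym (lastDigit≡lowPart%a₁ (suc n))) (≡ᵇ⇒≡ _ 0 d₀≡0)) (≡ᵇ⇒≡ _ 0 d₁≡0)
    reset-to : lowPart a (suc n) ≡ 0 → T (twoVolatileᵇ a n)
    reset-to reset = from T-∧ (≤⇒≤ᵇ (lowPart≡0⇒a₁≤ reset) , from T-∧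
      ( ≡⇒≡ᵇ _ 0 (trans (lastDigit≡lowPart%a₁ (suc n))
                   (trans (cong (λ x → modA x (a 1)) reset) (modA-zero (a 1))))
      , ≡⇒≡ᵇ _ 0 (trans (cong (λ x → divA x (a 1)) reset) (divA-zero (a 1)))))

  repWord-reset : ∀ n → lowPart a (suc n) ≡ 0 → repWord a n ≡ a 1
  repWord-reset n reset rewrite to T-≡ (from (twoVolatile⇔lowPart≡0 n) reset) = refl

  repWord-count : ∀ n → lowPart a (suc n) ≢ 0 → repWord a n ≡ lastDigit a n
  repWord-count n no-reset with twoVolatileᵇ a n in tv
  ... | true  = ⊥-elim (no-reset (to (twoVolatile⇔lowPart≡0 n) (from T-≡ tv)))
  ... | false = refl

  module Word = ResettingCounter (n<aₙ 1) (lowPart a) refl refl lowPart-step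
    (lastDigit a) lastDigit≡lowPart%a₁ (repWord a) repWord-reset repWord-count

proposition4p4 : (a : ℕ → ℕ) → IsRepresentingSequence a →
    (Fergusonian (a 1) (repWord a) ⇔
      (∀ m → repWord a m ≡ a 1 →
        Σ ℕ λ n → (m ≡ suc n) × ((repWord a n ≡ a 1 ∸ 1) ⊎ (repWord a n ≡ a 1))))
    ×
    ((∀ m → repWord a m ≡ a 1 →
        Σ ℕ λ n → (m ≡ suc n) × ((repWord a n ≡ a 1 ∸ 1) ⊎ (repWord a n ≡ a 1)))
      ⇔ (∀ n → repWord a n ≡ a 1 ⇔ (Volatile a n × Zend a n)))
proposition4p4 a (a0≡1 , a-increasing) =
  Word.fergusonian⇔topPreceded , Word.topPreceded⇔topsAreVolatileZends
  where open RepresentingSequence a0≡1 a-increasing
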